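{- Suppose $Act$ is finite. The axiom system $\mathcal{E}_{v,f}'=\mathcal{E}_v\cup\{O1\}\cup\mathcal{O}$ is sound modulo verdict equivalence: for all $m,n\in Mon_F$, if $\mathcal{E}_{v,f}'\vdash m=n$ then $m\simeq n$.
   Context: Fix a set $Act$ of visible actions, a symbol $\tau\notin Act$, and a countably infinite set $Var$ of variables disjoint from $Act\cup\{\tau\}$. Monitors $Mon_F$: $m,n ::= v \mid a.m \mid m+n \mid x$ ($a\in Act$, $x\in Var$), verdicts $v ::= \mathit{end}\mid \mathit{yes}\mid \mathit{no}$. Closed monitors contain no variables; (closed) substitutions map variables to (closed) monitors. $\sum_{i\in I}m_i$ is $\mathit{end}$ if $I=\emptyset$ and $m_{i_1}+\cdots+m_{i_k}$ otherwise. Transitions: for $\alpha\in Act\cup\{\tau\}$, $\xrightarrow{\alpha}$ is the least relation with $a.m\xrightarrow{a}m$; if $m\xrightarrow{\alpha}m'$ then $m+n\xrightarrow{\alpha}m'$ and $n+m\xrightarrow{\alpha}m'$; and $v\xrightarrow{\alpha}v$ for every verdict $v$ and every $\alpha$. Weak transitions: $m\xRightarrow{\varepsilon}m'$ iff $m(\xrightarrow{\tau})^*m'$; $m\xRightarrow{a}m'$ iff $m\xRightarrow{\varepsilon}m_1\xrightarrow{a}m_2\xRightarrow{\varepsilon}m'$; $m\xRightarrow{as'}m'$ ($s'\neq\varepsilon$) iff $m\xRightarrow{a}m_1\xRightarrow{s'}m'$. $L_a(m)=\{s\mid m\xRightarrow{s}\mathit{yes}\}$, $L_r(m)=\{s\mid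 m\xRightarrow{s}\mathit{no}\}$. Closed $m\simeq n$ iff $L_a(m)=L_a(n)$ and $L_r(m)=L_r(n)$; open $m\simeq n$ iff $\sigma(m)\simeq\sigma(n)$ for all closed $\sigma$. $\mathcal{E}\vdash m=n$: derivability by reflexivity, symmetry, transitivity, substitutivity and congruence for $a.\_$ and $+$. $\mathcal{E}_v$: (A1) $x+y=y+x$; (A2) $x+(y+z)=(x+y)+z$; (A3) $x+x=x$; (A4) $x+\mathit{end}=x$; for each $a\in Act$: $(E_a)$ $a.\mathit{end}=\mathit{end}$; $(Y_a)$ $\mathit{yes}=\mathit{yes}+a.\mathit{yes}$; $(N_a)$ $\mathit{no}=\mathit{no}+a.\mathit{no}$; $(D_a)$ $a.(x+y)=a.x+a.y$. $(O1)$: $\mathit{yes}+\mathit{no}=\mathit{yes}+\mathit{no}+x$. Notation for $s\in Act^*$, monitor $m$: $\mathit{pre}(s)$ = prefixes of $s$ (including $\varepsilon$, $s$); $s^1=s$, $s^i=ss^{i-1}$; for $s=a_1\cdots a_k$, $s.m=a_1.\cdots a_k.m$; $\overline{s}^{\leq}(m)=\sum_{|s'|\leq|s|,\ s'\notin\mathit{pre}(s)}s'.m$; $\overline{s}(m)=\overline{s}^{\leq}(m)+s.\sum_{a\in Act}a.m$; $\overline{s}^{(1)}(m)=\overline{s}(m)$ and for $k\geq 2$, $\overline{s}^{(k)}(m)=\sum_{1\leq i<k-1}s^i.\overline{s}^{\leq}(m)+s^{k-1}.\overline{s}(m)$. $\mathcal{O}$ is the family of equations $(O2_{s,k})$: $x+s.x+\overline{s}^{(k)}(\mathit{yes}+\mathit{no})=x+\overline{s}^{(k)}(\mathit{yes}+\mathit{no})$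 for all $s\in Act^*$ and all $k$ for which $\overline{s}^{(k)}$ is defined. -}

module Defs where

open import Data.Nat using (ℕ; zero; suc; _≤_; _<_)
open import Data.Fin using (Fin)
open import Data.Fin.Properties using (_≟_)
open import Data.List using (List; []; _∷_; map; concatMap; concat; filter; foldr; length)
open import Data.List.Base using (upTo)
open import Data.Fin.Base using ()
open import Data.Vec.Functional using ()
open import Data.Maybe using (Maybe; just; nothing)
open import Data.Bool using (Bool; true; false; not)
import Data.Bool
open import Data.Product using (_×_; _,_; Σ)
open import Relation.Nullary using (does)
open import Relation.Binary.PropositionalEquality using (_≡_)
open import Relation.Binary.Construct.Closure.ReflexiveTransitive using (Star)
open import Function.Bundles using (_⇔_)
import Data.List as L

-- The finite set of visible actions Act is modelled as Fin k (an arbitrary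
-- finite set, up to bijection).  tau is represented by 'nothing' in Maybe (Fin k).

data Verdict : Set where
  end yes no : Verdict

data Mon (k : ℕ) : Set where
  ver  : Verdict → Mon k
  _·_  : Fin k → Mon k → Mon k
  _⊕_  : Mon k → Mon k → Mon k
  var  : ℕ → Mon k

infixr 6 _·_
infixr 5 _⊕_

module _ {k : ℕ} where

  data Closed : Mon k → Set where
    c-ver : ∀ v → Closed (ver v)
    c-pre : ∀ a {m} → Closed m → Closed (a · m)
    c-sum : ∀ {m n} → Closed m → Closed n → Closed (m ⊕ n)

  Subst : Set
  Subst = ℕ → Mon k

  ClosedSubst : Subst → Set
  ClosedSubst σ = ∀ x → Closed (σ x)

  _[_] : Mon k → Subst → Mon k
  ver v   [ σ ] = ver v
  (a · m) [ σ ] = a · (m [ σ ])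
  (m ⊕ n) [ σ ] = (m [ σ ]) ⊕ (n [ σ ])
  var x   [ σ ] = σ x

  data Step : Mon k → Maybe (Fin k) → Mon k → Set where
    pre  : ∀ a m → Step (a · m) (just a) m
    sumˡ : ∀ {m m' α} n → Step m α m' → Step (m ⊕ n) α m'
    sumʳ : ∀ {m m' α} n → Step m α m' → Step (n ⊕ m) α m'
    verd : ∀ v α → Step (ver v) α (ver v)

  TauStar : Mon k → Mon k → Set
  TauStar = Star (λ m m' → Step m nothing m')

  data Weak : Mon k → List (Fin k) → Mon k → Set where
    weps  : ∀ {m m'} → TauStar m m' → Weak m [] m'
    wcons : ∀ {m m₁ m₂ m' a s} → TauStar m m₁ → Step m₁ (just a) m₂ →
            Weak m₂ s m' → Weak m (a ∷ s) m'

  La : Mon k → List (Fin k) → Set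
  La m s = Weak m s (ver yes)

  Lr : Mon k → List (Fin k) → Set
  Lr m s = Weak m s (ver no)

  _≃c_ : Mon k → Mon k → Set
  m ≃c n = (∀ s → La m s ⇔ La n s) × (∀ s → Lr m s ⇔ Lr n s)

  -- verdict equivalence on open monitors: under every closed substitution
  -- (for closed monitors this coincides with _≃c_)
  _≃_ : Mon k → Mon k → Set
  m ≃ n = ∀ σ → ClosedSubst σ → (m [ σ ]) ≃c (n [ σ ])

  Equations : Set₁
  Equations = Mon k → Mon k → Set

  data _⊢_≈_ (E : Equations) : Mon k → Mon k → Set where
    ax     : ∀ {m n} → E m n → E ⊢ m ≈ n
    refl'  : ∀ {m} → E ⊢ m ≈ m
    sym'   : ∀ {m n} → E ⊢ m ≈ n → E ⊢ n ≈ m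
    trans' : ∀ {m n o} → E ⊢ m ≈ n → E ⊢ n ≈ o → E ⊢ m ≈ o
    subst' : ∀ {m n} (σ : Subst) → E ⊢ m ≈ n → E ⊢ (m [ σ ]) ≈ (n [ σ ])
    cong·  : ∀ {m n} a → E ⊢ m ≈ n → E ⊢ (a · m) ≈ (a · n)
    cong⊕  : ∀ {m m' n n'} → E ⊢ m ≈ m' → E ⊢ n ≈ n' → E ⊢ (m ⊕ n) ≈ (m' ⊕ n')

  Sum : List (Mon k) → Mon k
  Sum []           = ver end
  Sum (m ∷ [])     = m
  Sum (m ∷ ms@(_ ∷ _)) = m ⊕ Sum ms

  allActs : List (Fin k)
  allActs = L.allFin k

  _◃_ : List (Fin k) → Mon k → Mon k
  s ◃ m = foldr _·_ m s

  isPrefix : List (Fin k) → List (Fin k) → Bool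
  isPrefix []       _        = true
  isPrefix (_ ∷ _)  []       = false
  isPrefix (a ∷ s) (b ∷ t) = does (a ≟ b) Data.Bool.∧ isPrefix s t

  wordsOf : ℕ → List (List (Fin k))
  wordsOf zero    = [] ∷ []
  wordsOf (suc n) = concatMap (λ a → map (a ∷_) (wordsOf n)) allActs

  wordsUpTo : ℕ → List (List (Fin k))
  wordsUpTo n = concatMap wordsOf (upTo (suc n))

  -- s^i  (i ≥ 1; s^0 = ε is harmless)
  pow : List (Fin k) → ℕ → List (Fin k)
  pow s zero    = []
  pow s (suc i) = s L.++ pow s i

  barLe : List (Fin k) → Mon k → Mon k
  barLe s m = Sum (map (λ s' → s' ◃ m)
                 (filter (λ s' → Data.Bool.T? (not (isPrefix s' s)))
                         (wordsUpTo (length s))))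

  bar : List (Fin k) → Mon k → Mon k
  bar s m = barLe s m ⊕ (s ◃ Sum (map (λ a → a · m) allActs))

  -- \overline{s}^{(k')}(m), defined for k' ≥ 1; argument j means k' = suc j
  -- j = 0 : bar s m ;  j = suc j' (k' = j'+2 ≥ 2) :
  --   Σ_{1 ≤ i < k'-1} s^i.barLe s m  +  s^{k'-1}.bar s m
  barK : List (Fin k) → ℕ → Mon k → Mon k
  barK s zero    m = bar s m
  barK s (suc j) m = Sum (map (λ i → pow s i ◃ barLe s m) (L.drop 1 (upTo (suc j))))
                     ⊕ (pow s (suc j) ◃ bar s m)

  x₀ y₀ z₀ : Mon k
  x₀ = var 0
  y₀ = var 1
  z₀ = var 2

  yn : Mon k
  yn = ver yes ⊕ ver no

  data E'vf : Equations where
    A1  : E'vf (x₀ ⊕ y₀) (y₀ ⊕ x₀)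
    A2  : E'vf (x₀ ⊕ (y₀ ⊕ z₀)) ((x₀ ⊕ y₀) ⊕ z₀)
    A3  : E'vf (x₀ ⊕ x₀) x₀
    A4  : E'vf (x₀ ⊕ ver end) x₀
    Ea  : ∀ a → E'vf (a · ver end) (ver end)
    Ya  : ∀ a → E'vf (ver yes) (ver yes ⊕ a · ver yes)
    Na  : ∀ a → E'vf (ver no) (ver no ⊕ a · ver no)
    Da  : ∀ a → E'vf (a · (x₀ ⊕ y₀)) ((a · x₀) ⊕ (a · y₀))
    O1  : E'vf (ver yes ⊕ ver no) ((ver yes ⊕ ver no) ⊕ x₀)
    -- O2_{s,k'} with k' = suc j ≥ 1
    O2  : ∀ (s : List (Fin k)) (j : ℕ) →
          E'vf ((x₀ ⊕ (s ◃ x₀)) ⊕ barK s j yn) (x₀ ⊕ barK s j yn)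

-- A weak run of a monitor to a verdict is determined by its syntax: m reaches
-- verdict t on s iff s is the label of a path in the syntax tree of m ending in
-- a t-leaf, followed by an arbitrary suffix (verdicts are irrevocable). On this
-- language-of-paths reading every rule of equational logic preserves the yes-
-- and no-languages, and so do all axioms except O2_{s,k}. For O2, suppose x
-- reaches a conclusive verdict on w, so that s.x reaches it on s w. Either w is
-- a prefix of s w, and then x itself reaches the verdict on s w, or w leaves
-- the periodic word s s s ... after e full periods, w = s^e p r with p a word of
-- length at most |s| that is not a prefix of s; then s w = s^(e+1) p r, which is
-- accepted and rejected by the padding term \overline{s}^{(k)}(yes + no).
module Submission where

open import Defs
open import Data.Nat using (ℕ; zero; suc; _+_; _≤_; _<_; s≤s; z≤n)
open import Data.Nat.Induction using (<-wellFounded)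
open import Data.Nat.Properties using (<-≤-connex; m≤n⇒∃[o]m+o≡n)
open import Data.Fin using (Fin)
open import Data.Fin.Properties using (_≟_)
open import Data.List using (List; []; _∷_; _++_; map; length; filter; applyUpTo)
open import Data.List.Properties using (++-assoc; ++-identityʳ; length-++-≤ʳ)
open import Data.List.Relation.Unary.Any using (Any; here; there)
open import Data.List.Relation.Unary.Any.Properties using (map⁺)
open import Data.List.Membership.Propositional using (_∈_; lose)
open import Data.List.Membership.Propositional.Properties
  using (∈-map⁺; ∈-concatMap⁺; ∈-applyUpTo⁺; ∈-upTo⁺; ∈-allFin; ∈-filter⁺)
open import Data.Maybe using (just; nothing)
open import Data.Bool using (true; false; not; T; _∧_)
open import Data.Bool.Properties using (T?)
open import Data.Product using (_×_; _,_; ∃; proj₂)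
open import Data.Product.Algebra using (×-distribˡ-⊎)
open import Data.Product.Function.NonDependent.Propositional using (_×-⇔_)
open import Data.Sum using (_⊎_; inj₁; inj₂; swap; assocˡ; assocʳ; reduce)
import Data.Sum as ⊎
open import Data.Sum.Function.Propositional using (_⊎-⇔_)
open import Data.Empty using (⊥; ⊥-elim)
open import Data.Unit using (tt)
open import Function using (id; _∘_; const)
open import Function.Bundles using (_⇔_; mk⇔)
import Function.Properties.Equivalence as ⇔
open import Function.Properties.Inverse using (↔⇒⇔)
open import Induction.WellFounded using (Acc; acc)
import Relation.Nullary as Dec
open import Relation.Nullary.Decidable using (dec-true; dec-false)
open import Relation.Binary.PropositionalEquality
  using (_≡_; _≢_; refl; sym; trans; cong; cong₂; subst)
open import Relation.Binary.Construct.Closure.ReflexiveTransitive using (ε; _◅_)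

module _ {k : ℕ} where

  Word : Set
  Word = List (Fin k)

  Reaches : Verdict → Mon k → Word → Set
  Reaches t (ver v) s       = v ≡ t
  Reaches t (a · m) []      = ⊥
  Reaches t (a · m) (b ∷ s) = a ≡ b × Reaches t m s
  Reaches t (m ⊕ n) s       = Reaches t m s ⊎ Reaches t n s
  Reaches t (var x) s       = ⊥

  Reaches-τ⁻ : ∀ {t m m' s} → Step m nothing m' → Reaches t m' s → Reaches t m s
  Reaches-τ⁻ (sumˡ n st) h = inj₁ (Reaches-τ⁻ st h)
  Reaches-τ⁻ (sumʳ n st) h = inj₂ (Reaches-τ⁻ st h)
  Reaches-τ⁻ (verd v _)  h = h

  Reaches-τ⋆⁻ : ∀ {t m m' s} → TauStar m m' → Reaches t m' s → Reaches t m s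
  Reaches-τ⋆⁻ ε         h = h
  Reaches-τ⋆⁻ (st ◅ τs) h = Reaches-τ⁻ st (Reaches-τ⋆⁻ τs h)

  Reaches-act⁻ : ∀ {t m m' a s} → Step m (just a) m' → Reaches t m' s → Reaches t m (a ∷ s)
  Reaches-act⁻ (pre a m)   h = refl , h
  Reaches-act⁻ (sumˡ n st) h = inj₁ (Reaches-act⁻ st h)
  Reaches-act⁻ (sumʳ n st) h = inj₂ (Reaches-act⁻ st h)
  Reaches-act⁻ (verd v _)  h = h

  Weak⇒Reaches : ∀ {t m s} → Weak m s (ver t) → Reaches t m s
  Weak⇒Reaches (weps τs)       = Reaches-τ⋆⁻ τs refl
  Weak⇒Reaches (wcons τs st w) = Reaches-τ⋆⁻ τs (Reaches-act⁻ st (Weak⇒Reaches w))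

  Weak-ver : ∀ t (s : Word) → Weak (ver t) s (ver t)
  Weak-ver t []      = weps ε
  Weak-ver t (a ∷ s) = wcons ε (verd t (just a)) (Weak-ver t s)

  -- A run into a verdict always takes a first step (verdicts τ-loop), so only
  -- that step has to be redirected.
  Weak-redirect : ∀ {t} {m m' : Mon k} {s} → (∀ {α o} → Step m α o → Step m' α o) →
                  Weak m s (ver t) → Weak m' s (ver t)
  Weak-redirect {t} f (weps ε)             = weps (f (verd t nothing) ◅ ε)
  Weak-redirect     f (weps (st ◅ τs))     = weps (f st ◅ τs)
  Weak-redirect     f (wcons ε st w)       = wcons ε (f st) w
  Weak-redirect     f (wcons (x ◅ τs) st w) = wcons (f x ◅ τs) st w

  Reaches⇒Weak : ∀ {t} m s → Reaches t m s → Weak m s (ver t)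
  Reaches⇒Weak (ver v) s        refl        = Weak-ver v s
  Reaches⇒Weak (a · m) (.a ∷ s) (refl , h)  = wcons ε (pre a m) (Reaches⇒Weak m s h)
  Reaches⇒Weak (m ⊕ n) s        (inj₁ h)    = Weak-redirect (sumˡ n) (Reaches⇒Weak m s h)
  Reaches⇒Weak (m ⊕ n) s        (inj₂ h)    = Weak-redirect (sumʳ m) (Reaches⇒Weak n s h)

  Weak⇔Reaches : ∀ {t} m s → Weak m s (ver t) ⇔ Reaches t m s
  Weak⇔Reaches m s = mk⇔ Weak⇒Reaches (Reaches⇒Weak m s)

  Reaches-++ : ∀ {t} m (w u : Word) → Reaches t m w → Reaches t m (w ++ u)
  Reaches-++ (ver v) w       u h        = h
  Reaches-++ (a · m) (b ∷ w) u (e , h)  = e , Reaches-++ m w u h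
  Reaches-++ (m ⊕ n) w       u (inj₁ h) = inj₁ (Reaches-++ m w u h)
  Reaches-++ (m ⊕ n) w       u (inj₂ h) = inj₂ (Reaches-++ n w u h)

  Reaches-◃⁺ : ∀ {t} (u : Word) m r → Reaches t m r → Reaches t (u ◃ m) (u ++ r)
  Reaches-◃⁺ []      m r h = h
  Reaches-◃⁺ (a ∷ u) m r h = refl , Reaches-◃⁺ u m r h

  Reaches-◃⁻ : ∀ {t} (u : Word) m v → Reaches t (u ◃ m) v →
               ∃ λ w → v ≡ u ++ w × Reaches t m w
  Reaches-◃⁻ []      m v        h          = v , refl , h
  Reaches-◃⁻ (a ∷ u) m (.a ∷ v) (refl , h) with Reaches-◃⁻ u m v h
  ... | w , refl , hw = w , refl , hw

  Reaches-Sum⁺ : ∀ {t} ms v → Any (λ m → Reaches t m v) ms → Reaches t (Sum ms) v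
  Reaches-Sum⁺ (m ∷ [])         v (here h)  = h
  Reaches-Sum⁺ (m ∷ _ ∷ _)      v (here h)  = inj₁ h
  Reaches-Sum⁺ (m ∷ ms@(_ ∷ _)) v (there h) = inj₂ (Reaches-Sum⁺ ms v h)

  Reaches-Sum-map⁺ : ∀ {t} {A : Set} (f : A → Mon k) {x xs} v →
                     x ∈ xs → Reaches t (f x) v → Reaches t (Sum (map f xs)) v
  Reaches-Sum-map⁺ f v x∈xs h = Reaches-Sum⁺ _ v (map⁺ (lose x∈xs h))

  data Conclusive : Verdict → Set where
    accept : Conclusive yes
    reject : Conclusive no

  end-inconclusive : ∀ {t} → Conclusive t → end ≢ t
  end-inconclusive accept ()
  end-inconclusive reject ()

  Reaches-yn : ∀ {t} → Conclusive t → ∀ s → Reaches t yn s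
  Reaches-yn accept s = inj₁ refl
  Reaches-yn reject s = inj₂ refl

  infix 4 _≋_

  _≋_ : Mon k → Mon k → Set
  m ≋ n = ∀ {t} → Conclusive t → ∀ s → Reaches t m s ⇔ Reaches t n s

  record Diverges (s p : Word) : Set where
    constructor mkDiverges
    field
      short     : length p ≤ length s
      notPrefix : isPrefix p s ≡ false

  Diverges-∷ : ∀ {a s p} → Diverges s p → Diverges (a ∷ s) (a ∷ p)
  Diverges-∷ {a} {s} {p} (mkDiverges short notPrefix) = mkDiverges (s≤s short)
    (trans (cong (_∧ isPrefix p s) (dec-true (a ≟ a) refl)) notPrefix)

  Diverges-head : ∀ {a b s} → b ≢ a → Diverges (a ∷ s) (b ∷ [])
  Diverges-head {a} {b} b≢a = mkDiverges (s≤s z≤n) (cong (_∧ true) (dec-false (b ≟ a) b≢a))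

  divergingWords : Word → List Word
  divergingWords s = filter (λ p → T? (not (isPrefix p s))) (wordsUpTo (length s))

  ∈-wordsOf : ∀ (p : Word) → p ∈ wordsOf (length p)
  ∈-wordsOf []      = here refl
  ∈-wordsOf (a ∷ p) = ∈-concatMap⁺ _ (lose (∈-allFin a) (∈-map⁺ (a ∷_) (∈-wordsOf p)))

  ∈-divergingWords : ∀ {s p} → Diverges s p → p ∈ divergingWords s
  ∈-divergingWords {s} {p} (mkDiverges short notPrefix) =
    ∈-filter⁺ (λ p → T? (not (isPrefix p s)))
      (∈-concatMap⁺ wordsOf (lose (∈-upTo⁺ (s≤s short)) (∈-wordsOf p)))
      (subst (T ∘ not) (sym notPrefix) tt)

  data Compare (s w : Word) : Set where
    prefix     : ∀ u → s ≡ w ++ u → Compare s w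
    extension  : ∀ w' → w ≡ s ++ w' → Compare s w
    divergence : ∀ {p} r → Diverges s p → w ≡ p ++ r → Compare s w

  compare : ∀ s w → Compare s w
  compare []      w       = extension w refl
  compare (a ∷ s) []      = prefix (a ∷ s) refl
  compare (a ∷ s) (b ∷ w) with b ≟ a
  ... | Dec.no b≢a = divergence w (Diverges-head b≢a) refl
  ... | Dec.yes refl with compare s w
  ...   | prefix u eq       = prefix u (cong (a ∷_) eq)
  ...   | extension w' eq   = extension w' (cong (a ∷_) eq)
  ...   | divergence r d eq = divergence r (Diverges-∷ d) (cong (a ∷_) eq)

  data PeriodicView (s w : Word) : Set where
    periodic : ∀ u → w ++ u ≡ s ++ w → PeriodicView s w
    deviates : ∀ e {p} r → Diverges s p → w ≡ pow s e ++ p ++ r → PeriodicView s w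

  periodicView : ∀ s w → PeriodicView s w
  periodicView []         w = periodic [] (++-identityʳ w)
  periodicView s@(_ ∷ s₀) w = go w (<-wellFounded (length w))
    where
    go : ∀ w → Acc _<_ (length w) → PeriodicView s w
    go w (acc rec) with compare s w
    ... | prefix u eq = periodic (u ++ w) (trans (sym (++-assoc w u w)) (cong (_++ w) (sym eq)))
    ... | divergence r d eq = deviates 0 r d eq
    ... | extension w' refl with go w' (rec (s≤s (length-++-≤ʳ w' {s₀})))
    ...   | periodic u eq = periodic u (trans (++-assoc s w' u) (cong (s ++_) eq))
    ...   | deviates e r d refl = deviates (suc e) r d (sym (++-assoc s (pow s e) _))

  pow-+ : ∀ (s : Word) m n → pow s (m + n) ≡ pow s m ++ pow s n
  pow-+ s zero    n = refl
  pow-+ s (suc m) n = trans (cong (s ++_) (pow-+ s m n)) (sym (++-assoc s (pow s m) (pow s n)))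

  _⨾_ : Subst {k} → Subst {k} → Subst {k}
  (τ ⨾ σ) x = τ x [ σ ]

  []-⨾ : ∀ m τ σ → (m [ τ ]) [ σ ] ≡ m [ τ ⨾ σ ]
  []-⨾ (ver v) τ σ = refl
  []-⨾ (a · m) τ σ = cong (a ·_) ([]-⨾ m τ σ)
  []-⨾ (m ⊕ n) τ σ = cong₂ _⊕_ ([]-⨾ m τ σ) ([]-⨾ n τ σ)
  []-⨾ (var x) τ σ = refl

  ◃-[] : ∀ (u : Word) m σ → (u ◃ m) [ σ ] ≡ u ◃ (m [ σ ])
  ◃-[] []      m σ = refl
  ◃-[] (a ∷ u) m σ = cong (a ·_) (◃-[] u m σ)

  Sum-map-[] : ∀ {A : Set} (f g : A → Mon k) xs σ → (∀ x → f x [ σ ] ≡ g x) →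
               Sum (map f xs) [ σ ] ≡ Sum (map g xs)
  Sum-map-[] f g []           σ eq = refl
  Sum-map-[] f g (x ∷ [])     σ eq = eq x
  Sum-map-[] f g (x ∷ y ∷ xs) σ eq = cong₂ _⊕_ (eq x) (Sum-map-[] f g (y ∷ xs) σ eq)

  barLe-[] : ∀ s m σ → barLe s m [ σ ] ≡ barLe s (m [ σ ])
  barLe-[] s m σ = Sum-map-[] (_◃ m) _ (divergingWords s) σ (λ s' → ◃-[] s' m σ)

  bar-[] : ∀ s m σ → bar s m [ σ ] ≡ bar s (m [ σ ])
  bar-[] s m σ = cong₂ _⊕_ (barLe-[] s m σ)
    (trans (◃-[] s _ σ) (cong (s ◃_) (Sum-map-[] (_· m) _ allActs σ (λ a → refl))))

  barK-[] : ∀ s j m σ → barK s j m [ σ ] ≡ barK s j (m [ σ ])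
  barK-[] s zero    m σ = bar-[] s m σ
  barK-[] s (suc j) m σ = cong₂ _⊕_
    (Sum-map-[] (λ i → pow s i ◃ barLe s m) _ (applyUpTo suc j) σ
      (λ i → trans (◃-[] (pow s i) _ σ) (cong (pow s i ◃_) (barLe-[] s m σ))))
    (trans (◃-[] (pow s (suc j)) _ σ) (cong (pow s (suc j) ◃_) (bar-[] s m σ)))

  barLe-covers : ∀ {t s p} m r → Diverges s p → Reaches t m r → Reaches t (barLe s m) (p ++ r)
  barLe-covers {p = p} m r d h =
    Reaches-Sum-map⁺ (_◃ m) (p ++ r) (∈-divergingWords d) (Reaches-◃⁺ p m r h)

  bar-covers-beyond : ∀ {t} → Conclusive t → ∀ s u b v → Reaches t (bar s yn) (s ++ u ++ b ∷ v)
  bar-covers-beyond c s []      b v = inj₂ (Reaches-◃⁺ s _ (b ∷ v)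
    (Reaches-Sum-map⁺ (_· yn) (b ∷ v) (∈-allFin b) (refl , Reaches-yn c v)))
  bar-covers-beyond c s (a ∷ u) b v = bar-covers-beyond c s [] a (u ++ b ∷ v)

  bar-covers : ∀ {t s p} → Conclusive t → Diverges s p → ∀ e r →
               Reaches t (bar s yn) (pow s e ++ p ++ r)
  bar-covers c d zero r = inj₁ (barLe-covers yn r d (Reaches-yn c r))
  bar-covers {p = []} c (mkDiverges _ ()) (suc e) r
  bar-covers {t} {s} {b ∷ p} c d (suc e) r =
    subst (Reaches t (bar s yn)) (sym (++-assoc s (pow s e) _))
      (bar-covers-beyond c s (pow s e) b (p ++ r))

  barK-covers : ∀ {t s p} → Conclusive t → Diverges s p → ∀ j i r →
                Reaches t (barK s j yn) (pow s (suc i) ++ p ++ r)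
  barK-covers c d zero    i r = bar-covers c d (suc i) r
  barK-covers {t} {s} {p} c d (suc j) i r with <-≤-connex i j
  ... | inj₁ i<j = inj₁ (Reaches-Sum-map⁺ (λ i → pow s i ◃ barLe s yn) _ (∈-applyUpTo⁺ suc i<j)
          (Reaches-◃⁺ (pow s (suc i)) _ (p ++ r) (barLe-covers yn r d (Reaches-yn c r))))
  ... | inj₂ j≤i with m≤n⇒∃[o]m+o≡n j≤i
  ...   | o , refl = inj₂ (subst (Reaches t (pow s (suc j) ◃ bar s yn)) split
          (Reaches-◃⁺ (pow s (suc j)) _ _ (bar-covers c d o r)))
    where
    split : pow s (suc j) ++ pow s o ++ p ++ r ≡ pow s (suc (j + o)) ++ p ++ r
    split = sym (trans (cong (_++ p ++ r) (pow-+ s (suc j) o))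
                       (++-assoc (pow s (suc j)) (pow s o) (p ++ r)))

  ◃-absorbed : ∀ {t} → Conclusive t → ∀ x s j v →
               Reaches t (s ◃ x) v → Reaches t (x ⊕ barK s j yn) v
  ◃-absorbed {t} c x s j v h with Reaches-◃⁻ s x v h
  ... | w , refl , hw with periodicView s w
  ...   | periodic u eq = inj₁ (subst (Reaches t x) eq (Reaches-++ x w u hw))
  ...   | deviates e r d refl = inj₂ (subst (Reaches t (barK s j yn))
          (++-assoc s (pow s e) _) (barK-covers c d j e r))

  Reaches-ver-absorbs : ∀ {t} v a (s : Word) → Reaches t (ver v ⊕ a · ver v) s → Reaches t (ver v) s
  Reaches-ver-absorbs v a s       (inj₁ h)       = h
  Reaches-ver-absorbs v a (b ∷ s) (inj₂ (_ , h)) = h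

  E'vf-sound : ∀ {m n} → E'vf m n → ∀ σ → m [ σ ] ≋ n [ σ ]
  E'vf-sound A1       σ c s       = mk⇔ swap swap
  E'vf-sound A2       σ c s       = mk⇔ assocˡ assocʳ
  E'vf-sound A3       σ c s       = mk⇔ reduce inj₁
  E'vf-sound A4       σ c s       = mk⇔ ⊎.[ id , ⊥-elim ∘ end-inconclusive c ] inj₁
  E'vf-sound (Ea a)   σ c []      = mk⇔ (λ ()) (⊥-elim ∘ end-inconclusive c)
  E'vf-sound (Ea a)   σ c (b ∷ s) = mk⇔ proj₂ (⊥-elim ∘ end-inconclusive c)
  E'vf-sound (Ya a)   σ c s       = mk⇔ inj₁ (Reaches-ver-absorbs yes a s)
  E'vf-sound (Na a)   σ c s       = mk⇔ inj₁ (Reaches-ver-absorbs no a s)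
  E'vf-sound (Da a)   σ c []      = mk⇔ (λ ()) ⊎.[ (λ ()) , (λ ()) ]
  E'vf-sound (Da a)   σ c (b ∷ s) = ↔⇒⇔ (×-distribˡ-⊎ _ _ _ _)
  E'vf-sound O1       σ c s       = mk⇔ inj₁ (const (Reaches-yn c s))
  E'vf-sound (O2 s j) σ c v
    rewrite ◃-[] s x₀ σ | barK-[] s j yn σ =
    mk⇔ ⊎.[ ⊎.[ inj₁ , ◃-absorbed c (σ 0) s j v ] , inj₂ ] ⊎.[ inj₁ ∘ inj₁ , inj₂ ]

  ⊢-sound : ∀ {m n} → E'vf ⊢ m ≈ n → ∀ σ → m [ σ ] ≋ n [ σ ]
  ⊢-sound (ax e)          σ = E'vf-sound e σ
  ⊢-sound refl'           σ c s = ⇔.refl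
  ⊢-sound (sym' d)        σ c s = ⇔.sym (⊢-sound d σ c s)
  ⊢-sound (trans' d₁ d₂)  σ c s = ⇔.trans (⊢-sound d₁ σ c s) (⊢-sound d₂ σ c s)
  ⊢-sound (subst' {m} {n} τ d) σ rewrite []-⨾ m τ σ | []-⨾ n τ σ = ⊢-sound d (τ ⨾ σ)
  ⊢-sound (cong· a d)     σ c []      = ⇔.refl
  ⊢-sound (cong· a d)     σ c (b ∷ s) = ⇔.refl ×-⇔ ⊢-sound d σ c s
  ⊢-sound (cong⊕ d₁ d₂)   σ c s = ⊢-sound d₁ σ c s ⊎-⇔ ⊢-sound d₂ σ c s

lemma12 : (k : ℕ) (m n : Mon k) → E'vf ⊢ m ≈ n → m ≃ n
lemma12 k m n m≈n σ _ = agree accept , agree reject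
  where
  agree : ∀ {t} → Conclusive t → ∀ s → Weak (m [ σ ]) s (ver t) ⇔ Weak (n [ σ ]) s (ver t)
  agree c s = ⇔.trans (Weak⇔Reaches _ s) (⇔.trans (⊢-sound m≈n σ c s) (⇔.sym (Weak⇔Reaches _ s)))
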